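{- Let $\rho=\sum_{i\ge0}b_{i+1}q_i$ be an $\alpha$-number of a slope $\alpha$ with continuants $(q_n)_{n\ge-1}$, write $\rho_n=\sum_{i=0}^{n-1}b_{i+1}q_i$, and for $n\ge1$ set $\lambda_n=q_{n+1}+q_n-\rho_{n+1}-2$. Then for every $n\ge1$: (1) the words $T^{\rho_n}(c_\alpha)$ and $T^{\rho_{n+1}}(c_\alpha)$ have the same prefix of length $\lambda_n$; (2) if $b_{n+1}\neq0$, then $\lambda_n$ is the length of the longest common prefix of $T^{\rho_n}(c_\alpha)$ and $T^{\rho_{n+1}}(c_\alpha)$; (3) the sequence $(\lambda_n)_{n\ge1}$ is nondecreasing and tends to $+\infty$.
   Context: Slope: irrational $\alpha\in(0,1)$, $\alpha=[0;a_1,a_2,\ldots]$; continuants $q_{ -1}=0,q_0=1,q_{n+1}=a_{n+1}q_n+q_{n-1}$. Standard words $s_{ -1}=1,s_0=0,s_1=s_0^{a_1-1}s_{ -1},s_{n+1}=s_n^{a_{n+1}}s_{n-1}$; characteristic word $c_\alpha=\lim s_n$; $T$ is the shift. Ostrowski conditions on $(b_i)_{i\ge1}$: $0\le b_1\le a_1-1$, $0\le b_i\le a_i$, $b_{i+1}=a_{i+1}\Rightarrow b_i=0$. An $\alpha$-number is a formal sum $\rho=\sum_{i\ge0}b_{i+1}q_i$ with $(b_i)$ satisfying these conditions (not necessarily eventually zero). -}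

module Defs where

open import Data.Nat using (ℕ; zero; suc; _+_; _*_; _∸_; _≤_; _<_)
open import Data.Product using (_×_; _,_; proj₁; proj₂)
open import Data.List using (List; []; _∷_; _++_)
open import Relation.Binary.PropositionalEquality using (_≡_; _≢_)

-- Convention: sequences (a_i)_{i≥1}, (b_i)_{i≥1} are functions ℕ → ℕ;
-- the value at index 0 is ignored.

-- A slope α = [0; a₁, a₂, …] (irrational, in (0,1)) is given by its
-- partial quotients: all a_i ≥ 1 for i ≥ 1.
IsSlope : (ℕ → ℕ) → Set
IsSlope a = ∀ i → 1 ≤ a (suc i)

-- cont a n = (q_{n-1} , q_n)
cont : (ℕ → ℕ) → ℕ → ℕ × ℕ
cont a zero = 0 , 1
cont a (suc n) with cont a n
... | (qp , qn) = qn , a (suc n) * qn + qp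

q : (ℕ → ℕ) → ℕ → ℕ
q a n = proj₂ (cont a n)

rep : ℕ → List ℕ → List ℕ
rep zero u = []
rep (suc k) u = u ++ rep k u

-- sw a n = (s_{n-1} , s_n) ; letters 0 and 1 are the naturals 0, 1
sw : (ℕ → ℕ) → ℕ → List ℕ × List ℕ
sw a zero = (1 ∷ []) , (0 ∷ [])
sw a (suc zero) = (0 ∷ []) , (rep (a 1 ∸ 1) (0 ∷ []) ++ (1 ∷ []))
sw a (suc (suc n)) with sw a (suc n)
... | (sp , sn) = sn , (rep (a (suc (suc n))) sn ++ sp)

s : (ℕ → ℕ) → ℕ → List ℕ
s a n = proj₂ (sw a n)

-- k-th letter (0-based) of a finite word, default 0 if out of range
nth : List ℕ → ℕ → ℕ
nth [] k = 0
nth (x ∷ u) zero = x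
nth (x ∷ u) (suc k) = nth u k

-- Characteristic word c_α = lim s_n, as an infinite word ℕ → ℕ.
-- Since |s_{k+1}| = q_{k+1} ≥ k+1 and s_n is a prefix of s_{n+1} for
-- n ≥ 1, the k-th letter of the limit is the k-th letter of s_{k+1}.
charWord : (ℕ → ℕ) → ℕ → ℕ
charWord a k = nth (s a (suc k)) k

T^ : ℕ → (ℕ → ℕ) → (ℕ → ℕ)
T^ r w k = w (r + k)

IsAlphaNumber : (ℕ → ℕ) → (ℕ → ℕ) → Set
IsAlphaNumber a b =
  (b 1 ≤ a 1 ∸ 1) ×
  (∀ i → b (suc i) ≤ a (suc i)) ×
  (∀ i → b (suc (suc i)) ≡ a (suc (suc i)) → b (suc i) ≡ 0)

rho : (ℕ → ℕ) → (ℕ → ℕ) → ℕ → ℕ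
rho a b zero = 0
rho a b (suc n) = rho a b n + b (suc n) * q a n

-- λ_n = q_{n+1} + q_n − ρ_{n+1} − 2  (nonnegative for α-numbers)
lam : (ℕ → ℕ) → (ℕ → ℕ) → ℕ → ℕ
lam a b n = ((q a (suc n) + q a n) ∸ rho a b (suc n)) ∸ 2

SamePrefix : (ℕ → ℕ) → (ℕ → ℕ) → ℕ → Set
SamePrefix u v m = ∀ k → k < m → u k ≡ v k

IsLCPLength : (ℕ → ℕ) → (ℕ → ℕ) → ℕ → Set
IsLCPLength u v m = SamePrefix u v m × (u m ≢ v m)

-- The standard words almost commute: s_{n+1} s_n = W x y and s_n s_{n+1} = W y x with x ≠ y.
-- As c_α begins with s_{n+1} s_n, its prefix of length q_{n+1} + q_n − 2 = |W| has period q_n,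
-- and the period breaks at the next letter. The Ostrowski conditions give
-- ρ_{n+1} = ρ_n + b_{n+1} q_n < q_{n+1}, so the shifts by ρ_n and ρ_{n+1} differ by a multiple of
-- the period and agree exactly up to |W| − ρ_{n+1} = λ_n (a mismatch there if b_{n+1} ≠ 0).
-- Finally b_{n+2} ≤ a_{n+2} makes λ_n nondecreasing, and λ_n ≥ q_n − 1 ≥ n − 1.
module Submission where

open import Defs
open import Data.Nat using (ℕ; zero; suc; _+_; _*_; _∸_; _≤_; _<_; z≤n; s≤s; >-nonZero)
open import Data.Nat.Properties
open import Data.Nat.Tactic.RingSolver using (solve-∀)
open import Data.Product using (_×_; ∃; ∃-syntax; _,_; proj₁; proj₂)
open import Data.Sum using (inj₁; inj₂)
open import Data.List using (List; []; _∷_; _++_; length)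
open import Data.List.Properties using (++-assoc; length-++; ++-identityʳ)
open import Data.Empty using (⊥-elim)
open import Relation.Binary.PropositionalEquality

nth-++ˡ : ∀ (u v : List ℕ) {k} → k < length u → nth (u ++ v) k ≡ nth u k
nth-++ˡ (x ∷ u) v {zero}  _         = refl
nth-++ˡ (x ∷ u) v {suc k} (s≤s k<u) = nth-++ˡ u v k<u

nth-++ʳ : ∀ (u v : List ℕ) k → nth (u ++ v) (length u + k) ≡ nth v k
nth-++ʳ []      v k = refl
nth-++ʳ (x ∷ u) v k = nth-++ʳ u v k

nth-++-length : ∀ (u v : List ℕ) x → nth (u ++ x ∷ v) (length u) ≡ x
nth-++-length []      v x = refl
nth-++-length (y ∷ u) v x = nth-++-length u v x

length-rep : ∀ k (u : List ℕ) → length (rep k u) ≡ k * length u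
length-rep zero    u = refl
length-rep (suc k) u = trans (length-++ u) (cong (length u +_) (length-rep k u))

rep-comm : ∀ k (u : List ℕ) → u ++ rep k u ≡ rep k u ++ u
rep-comm zero    u = ++-identityʳ u
rep-comm (suc k) u = trans (cong (u ++_) (rep-comm k u)) (sym (++-assoc u (rep k u) u))

Prefix : List ℕ → List ℕ → Set
Prefix u v = ∃[ r ] u ++ r ≡ v

prefix-refl : ∀ u → Prefix u u
prefix-refl u = [] , ++-identityʳ u

prefix-trans : ∀ {u v w} → Prefix u v → Prefix v w → Prefix u w
prefix-trans {u} (r , refl) (r′ , refl) = r ++ r′ , sym (++-assoc u r r′)

prefix-++ʳ : ∀ {u v} w → Prefix u v → Prefix u (v ++ w)
prefix-++ʳ w p = prefix-trans p (w , refl)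

prefix-++ˡ : ∀ u {v w} → Prefix v w → Prefix (u ++ v) (u ++ w)
prefix-++ˡ u {v} (r , refl) = r , ++-assoc u v r

nth-prefix : ∀ {u v} → Prefix u v → ∀ {k} → k < length u → nth v k ≡ nth u k
nth-prefix {u} (r , refl) = nth-++ˡ u r

prefix-rep-++ : ∀ k {u v} → 1 ≤ k → Prefix u (rep k u ++ v)
prefix-rep-++ (suc k) {u} {v} _ = rep k u ++ v , sym (++-assoc u (rep k u) v)

prefix-rep-++-self : ∀ k {u v} → Prefix v u → Prefix v (rep k u ++ v)
prefix-rep-++-self zero    {v = v} _ = prefix-refl v
prefix-rep-++-self (suc k) {u} {v} v≼u =
  subst (Prefix v) (sym (++-assoc u (rep k u) v)) (prefix-++ʳ (rep k u ++ v) v≼u)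

prefix-++-rep-++ : ∀ k {u v} → 1 ≤ k → Prefix v u → Prefix (u ++ v) (rep k u ++ v)
prefix-++-rep-++ (suc k) {u} {v} _ v≼u =
  subst (Prefix (u ++ v)) (sym (++-assoc u (rep k u) v)) (prefix-++ˡ u (prefix-rep-++-self k v≼u))

AlmostCommute : List ℕ → List ℕ → Set
AlmostCommute u v =
  ∃[ W ] ∃[ x ] ∃[ y ] x ≢ y × u ++ v ≡ W ++ x ∷ y ∷ [] × v ++ u ≡ W ++ y ∷ x ∷ []

almostCommute-rep-++ : ∀ k {u v} → AlmostCommute u v → AlmostCommute (rep k u ++ v) u
almostCommute-rep-++ k {u} {v} (W , x , y , x≢y , uv≡ , vu≡) =
  rep k u ++ W , y , x , (λ y≡x → x≢y (sym y≡x)) , wu≡ , uw≡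
  where
    open ≡-Reasoning
    wu≡ : (rep k u ++ v) ++ u ≡ (rep k u ++ W) ++ y ∷ x ∷ []
    wu≡ = begin
      (rep k u ++ v) ++ u          ≡⟨ ++-assoc (rep k u) v u ⟩
      rep k u ++ v ++ u            ≡⟨ cong (rep k u ++_) vu≡ ⟩
      rep k u ++ W ++ y ∷ x ∷ []   ≡⟨ ++-assoc (rep k u) W _ ⟨
      (rep k u ++ W) ++ y ∷ x ∷ [] ∎
    uw≡ : u ++ rep k u ++ v ≡ (rep k u ++ W) ++ x ∷ y ∷ []
    uw≡ = begin
      u ++ rep k u ++ v            ≡⟨ ++-assoc u (rep k u) v ⟨
      (u ++ rep k u) ++ v          ≡⟨ cong (_++ v) (rep-comm k u) ⟩
      (rep k u ++ u) ++ v          ≡⟨ ++-assoc (rep k u) u v ⟩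
      rep k u ++ u ++ v            ≡⟨ cong (rep k u ++_) uv≡ ⟩
      rep k u ++ W ++ x ∷ y ∷ []   ≡⟨ ++-assoc (rep k u) W _ ⟨
      (rep k u ++ W) ++ x ∷ y ∷ [] ∎

HasPeriodBelow : (ℕ → ℕ) → ℕ → ℕ → Set
HasPeriodBelow w p L = ∀ i → i + p < L → w i ≡ w (i + p)

PeriodBrokenAt : (ℕ → ℕ) → ℕ → ℕ → Set
PeriodBrokenAt w p L = HasPeriodBelow w p L × (∀ j → j + p ≡ L → w j ≢ w L)

module _ {w : ℕ → ℕ} {p L : ℕ} (periodic : HasPeriodBelow w p L) where

  hasPeriodBelow-* : ∀ k i → i + k * p < L → w i ≡ w (i + k * p)
  hasPeriodBelow-* zero    i _ = cong w (sym (+-identityʳ i))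
  hasPeriodBelow-* (suc k) i i+p+kp<L = begin
    w i               ≡⟨ hasPeriodBelow-* k i (≤-<-trans (+-monoʳ-≤ i (m≤n+m (k * p) p)) i+p+kp<L) ⟩
    w (i + k * p)     ≡⟨ periodic (i + k * p) (subst (_< L) (sym regroup) i+p+kp<L) ⟩
    w (i + k * p + p) ≡⟨ cong w regroup ⟩
    w (i + (p + k * p)) ∎
    where
      open ≡-Reasoning
      regroup : i + k * p + p ≡ i + (p + k * p)
      regroup = trans (+-assoc i (k * p) p) (cong (i +_) (+-comm (k * p) p))

  samePrefix-shift-period : ∀ r B l → r + B * p + l ≡ L →
    SamePrefix (T^ r w) (T^ (r + B * p) w) l
  samePrefix-shift-period r B l r+Bp+l≡L k k<l =
    trans (hasPeriodBelow-* B (r + k) (subst (_< L) (swap r (B * p) k) (subst (r + B * p + k <_) r+Bp+l≡L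
            (+-monoʳ-< (r + B * p) k<l))))
          (cong w (sym (swap r (B * p) k)))
    where
      swap : ∀ r m k → r + m + k ≡ r + k + m
      swap = solve-∀

  isLCPLength-shift-period : 1 ≤ p → (∀ j → j + p ≡ L → w j ≢ w L) →
    ∀ r B l → r + B * p + l ≡ L → B ≢ 0 → IsLCPLength (T^ r w) (T^ (r + B * p) w) l
  isLCPLength-shift-period _ _ r zero l _ B≢0 = ⊥-elim (B≢0 refl)
  isLCPLength-shift-period 1≤p broken r (suc B) l r+Bp+l≡L _ =
    samePrefix-shift-period r (suc B) l r+Bp+l≡L , mismatch
    where
      j = r + l + B * p
      j+p≡L : j + p ≡ L
      j+p≡L = trans (regroup r l (B * p) p) r+Bp+l≡L
        where
          regroup : ∀ r l m p → r + l + m + p ≡ r + (p + m) + l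
          regroup = solve-∀
      mismatch : w (r + l) ≢ w (r + suc B * p + l)
      mismatch eq = broken j j+p≡L (begin
        w j           ≡⟨ hasPeriodBelow-* B (r + l) (subst (j <_) j+p≡L (m<m+n j 1≤p)) ⟨
        w (r + l)     ≡⟨ eq ⟩
        w (r + suc B * p + l) ≡⟨ cong w r+Bp+l≡L ⟩
        w L           ∎)
        where open ≡-Reasoning

-- Below |W|, position |v| + i of v ++ u equals position |v| + i of u ++ v and, for i < |u|,
-- position i of u ++ v; hence the period |v|.
almostCommute⇒periodBrokenAt : ∀ {w : ℕ → ℕ} {u v} → AlmostCommute u v →
  (∀ k → k < length (u ++ v) → w k ≡ nth (u ++ v) k) →
  PeriodBrokenAt w (length v) (length (u ++ v) ∸ 2)
almostCommute⇒periodBrokenAt {w} {u} {v} (W , x , y , x≢y , uv≡ , vu≡) agree =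
  subst (PeriodBrokenAt w (length v)) (sym |uv|∸2≡|W|) (periodic , broken)
  where
    open ≡-Reasoning
    L = length W

    |uv|≡L+2 : length (u ++ v) ≡ L + 2
    |uv|≡L+2 = trans (cong length uv≡) (length-++ W)

    |uv|∸2≡|W| : length (u ++ v) ∸ 2 ≡ L
    |uv|∸2≡|W| = trans (cong (_∸ 2) |uv|≡L+2) (m+n∸n≡m L 2)

    L<|uv| : L < length (u ++ v)
    L<|uv| = subst (L <_) (sym |uv|≡L+2) (m<m+n L (s≤s z≤n))

    <L⇒<|uv| : ∀ {k} → k < L → k < length (u ++ v)
    <L⇒<|uv| k<L = <-trans k<L L<|uv|

    +|v|<|uv|⇒<|u| : ∀ {i} → i + length v < length (u ++ v) → i < length u
    +|v|<|uv|⇒<|u| {i} h = +-cancelʳ-< (length v) i (length u) (subst (i + length v <_) (length-++ u) h)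

    w≡nth-W : ∀ k → k < L → w k ≡ nth W k
    w≡nth-W k k<L = begin
      w k                         ≡⟨ agree k (<L⇒<|uv| k<L) ⟩
      nth (u ++ v) k              ≡⟨ cong (λ z → nth z k) uv≡ ⟩
      nth (W ++ x ∷ y ∷ []) k     ≡⟨ nth-++ˡ W _ k<L ⟩
      nth W k                     ∎

    w≡nth-vu : ∀ i → i < length u → w i ≡ nth (v ++ u) (length v + i)
    w≡nth-vu i i<u = begin
      w i                         ≡⟨ agree i (subst (i <_) (sym (length-++ u)) (≤-trans i<u (m≤m+n _ _))) ⟩
      nth (u ++ v) i              ≡⟨ nth-++ˡ u v i<u ⟩
      nth u i                     ≡⟨ nth-++ʳ v u i ⟨
      nth (v ++ u) (length v + i) ∎

    periodic : HasPeriodBelow w (length v) L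
    periodic i i+v<L = begin
      w i                           ≡⟨ w≡nth-vu i (+|v|<|uv|⇒<|u| (<L⇒<|uv| i+v<L)) ⟩
      nth (v ++ u) (length v + i)   ≡⟨ cong (λ z → nth z (length v + i)) vu≡ ⟩
      nth (W ++ y ∷ x ∷ []) (length v + i) ≡⟨ nth-++ˡ W _ v+i<L ⟩
      nth W (length v + i)          ≡⟨ w≡nth-W _ v+i<L ⟨
      w (length v + i)              ≡⟨ cong w (+-comm (length v) i) ⟩
      w (i + length v)              ∎
      where v+i<L = subst (_< L) (+-comm i (length v)) i+v<L

    broken : ∀ j → j + length v ≡ L → w j ≢ w L
    broken j j+v≡L wj≡wL = x≢y (begin
      x                             ≡⟨ nth-++-length W _ x ⟨
      nth (W ++ x ∷ y ∷ []) L       ≡⟨ cong (λ z → nth z L) uv≡ ⟨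
      nth (u ++ v) L                ≡⟨ agree L L<|uv| ⟨
      w L                           ≡⟨ wj≡wL ⟨
      w j                           ≡⟨ w≡nth-vu j j<u ⟩
      nth (v ++ u) (length v + j)   ≡⟨ cong₂ nth vu≡ (trans (+-comm (length v) j) j+v≡L) ⟩
      nth (W ++ y ∷ x ∷ []) L       ≡⟨ nth-++-length W _ y ⟩
      y                             ∎)
      where
        j<u = +|v|<|uv|⇒<|u| (subst (_< length (u ++ v)) (sym j+v≡L) L<|uv|)

module _ (a : ℕ → ℕ) where

  s-recurrence : ∀ n → s a (suc (suc n)) ≡ rep (a (suc (suc n))) (s a (suc n)) ++ s a n
  s-recurrence n = trans (cong proj₂ (sw-suc-suc n)) (cong (rep (a (suc (suc n))) (s a (suc n)) ++_) (proj₁-sw n))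
    where
      sw-suc-suc : ∀ n → sw a (suc (suc n)) ≡ (s a (suc n) , rep (a (suc (suc n))) (s a (suc n)) ++ proj₁ (sw a (suc n)))
      sw-suc-suc n with sw a (suc n)
      ... | _ = refl
      proj₁-sw : ∀ n → proj₁ (sw a (suc n)) ≡ s a n
      proj₁-sw zero    = refl
      proj₁-sw (suc n) = cong proj₁ (sw-suc-suc n)

  q-recurrence : ∀ n → q a (suc (suc n)) ≡ a (suc (suc n)) * q a (suc n) + q a n
  q-recurrence n = trans (cong proj₂ (cont-suc (suc n))) (cong (a (suc (suc n)) * q a (suc n) +_) (cong proj₁ (cont-suc n)))
    where
      cont-suc : ∀ n → cont a (suc n) ≡ (q a n , a (suc n) * q a n + proj₁ (cont a n))
      cont-suc n with cont a n
      ... | _ = refl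

  module _ (slope : IsSlope a) where

    length-s : ∀ n → length (s a n) ≡ q a n
    length-s zero = refl
    length-s (suc zero) with a 1 | slope 0
    ... | suc k | _ = begin
      length (rep k (0 ∷ []) ++ 1 ∷ [])   ≡⟨ length-++ (rep k (0 ∷ [])) ⟩
      length (rep k (0 ∷ [])) + 1         ≡⟨ cong (_+ 1) (length-rep k (0 ∷ [])) ⟩
      k * 1 + 1                           ≡⟨ +-comm (k * 1) 1 ⟩
      suc k * 1                           ≡⟨ +-identityʳ (suc k * 1) ⟨
      suc k * 1 + 0                       ∎
      where open ≡-Reasoning
    length-s (suc (suc n)) = begin
      length (s a (suc (suc n)))                                   ≡⟨ cong length (s-recurrence n) ⟩
      length (rep (a (suc (suc n))) (s a (suc n)) ++ s a n)         ≡⟨ length-++ (rep (a (suc (suc n))) (s a (suc n))) ⟩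
      length (rep (a (suc (suc n))) (s a (suc n))) + length (s a n) ≡⟨ cong₂ _+_ (length-rep (a (suc (suc n))) (s a (suc n))) (length-s n) ⟩
      a (suc (suc n)) * length (s a (suc n)) + q a n                ≡⟨ cong (λ z → a (suc (suc n)) * z + q a n) (length-s (suc n)) ⟩
      a (suc (suc n)) * q a (suc n) + q a n                         ≡⟨ q-recurrence n ⟨
      q a (suc (suc n))                                             ∎
      where open ≡-Reasoning

    q[n+1]+q[n]≤q[n+2] : ∀ n → q a (suc n) + q a n ≤ q a (suc (suc n))
    q[n+1]+q[n]≤q[n+2] n = subst (q a (suc n) + q a n ≤_) (sym (q-recurrence n))
      (+-monoˡ-≤ (q a n) (m≤n*m (q a (suc n)) (a (suc (suc n))) {{>-nonZero (slope (suc n))}}))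

    0<q : ∀ n → 0 < q a n
    0<q zero = s≤s z≤n
    0<q (suc zero) with a 1 | slope 0
    ... | suc _ | _ = s≤s z≤n
    0<q (suc (suc n)) = <-≤-trans (0<q n) (≤-trans (m≤n+m (q a n) (q a (suc n))) (q[n+1]+q[n]≤q[n+2] n))

    n≤q : ∀ n → n ≤ q a n
    n≤q zero          = z≤n
    n≤q (suc zero)    = 0<q 1
    n≤q (suc (suc n)) = ≤-trans (≤-trans (≤-reflexive (+-comm 1 (suc n))) (+-mono-≤ (n≤q (suc n)) (0<q n)))
                                (q[n+1]+q[n]≤q[n+2] n)

    s-prefix-step : ∀ n → Prefix (s a (suc n)) (s a (suc (suc n)))
    s-prefix-step n = subst (Prefix (s a (suc n))) (sym (s-recurrence n)) (prefix-rep-++ _ (slope (suc n)))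

    s-prefix-s : ∀ {m n} → m ≤ n → Prefix (s a (suc m)) (s a (suc n))
    s-prefix-s {m} m≤n with m≤n⇒∃[o]m+o≡n m≤n
    ... | d , refl = prefix-+ d
      where
        prefix-+ : ∀ d → Prefix (s a (suc m)) (s a (suc (m + d)))
        prefix-+ zero    = subst (λ n → Prefix (s a (suc m)) (s a (suc n))) (sym (+-identityʳ m)) (prefix-refl _)
        prefix-+ (suc d) = subst (λ n → Prefix (s a (suc m)) (s a (suc n))) (sym (+-suc m d))
                             (prefix-trans (prefix-+ d) (s-prefix-step (m + d)))

    charWord≡nth-s : ∀ n k → k < q a (suc n) → charWord a k ≡ nth (s a (suc n)) k
    charWord≡nth-s n k k<q with ≤-total k n
    ... | inj₁ k≤n = sym (nth-prefix (s-prefix-s k≤n) (subst (k <_) (sym (length-s (suc k))) (n≤q (suc k))))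
    ... | inj₂ n≤k = nth-prefix (s-prefix-s n≤k) (subst (k <_) (sym (length-s (suc n))) k<q)

    length-s++s : ∀ n → length (s a (suc n) ++ s a n) ≡ q a (suc n) + q a n
    length-s++s n = trans (length-++ (s a (suc n))) (cong₂ _+_ (length-s (suc n)) (length-s n))

    charWord≡nth-s++s : ∀ n k → k < length (s a (suc (suc n)) ++ s a (suc n)) →
      charWord a k ≡ nth (s a (suc (suc n)) ++ s a (suc n)) k
    charWord≡nth-s++s n k k<|ss| = trans (charWord≡nth-s (suc (suc n)) k k<q) (nth-prefix ss≼s k<|ss|)
      where
        k<q = <-≤-trans (subst (k <_) (length-s++s (suc n)) k<|ss|) (q[n+1]+q[n]≤q[n+2] (suc n))
        ss≼s : Prefix (s a (suc (suc n)) ++ s a (suc n)) (s a (suc (suc (suc n))))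
        ss≼s = subst (Prefix _) (sym (s-recurrence (suc n)))
                 (prefix-++-rep-++ _ (slope (suc (suc n))) (s-prefix-step n))

    almostCommute-s : ∀ n → AlmostCommute (s a (suc n)) (s a n)
    almostCommute-s zero =
      rep (a 1 ∸ 1) (0 ∷ []) , 1 , 0 , (λ ()) ,
      ++-assoc (rep (a 1 ∸ 1) (0 ∷ [])) (1 ∷ []) (0 ∷ []) ,
      trans (cong (_++ 1 ∷ []) (rep-comm (a 1 ∸ 1) (0 ∷ []))) (++-assoc (rep (a 1 ∸ 1) (0 ∷ [])) (0 ∷ []) (1 ∷ []))
    almostCommute-s (suc n) = subst (λ z → AlmostCommute z (s a (suc n))) (sym (s-recurrence n))
      (almostCommute-rep-++ (a (suc (suc n))) (almostCommute-s n))

    -- The analogous statement for q₀ fails: s₁ s₀ is not a prefix of c_α when a₁ = 1.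
    charWord-periodBrokenAt : ∀ n →
      PeriodBrokenAt (charWord a) (q a (suc n)) ((q a (suc (suc n)) + q a (suc n)) ∸ 2)
    charWord-periodBrokenAt n =
      subst₂ (λ p l → PeriodBrokenAt (charWord a) p (l ∸ 2)) (length-s (suc n)) (length-s++s (suc n))
        (almostCommute⇒periodBrokenAt {u = s a (suc (suc n))} {s a (suc n)} (almostCommute-s (suc n)) (charWord≡nth-s++s n))

m+[n∸m∸2]≡n∸2 : ∀ {m n} → m + 2 ≤ n → m + ((n ∸ m) ∸ 2) ≡ n ∸ 2
m+[n∸m∸2]≡n∸2 {m} {n} m+2≤n = begin
  m + ((n ∸ m) ∸ 2) ≡⟨ +-∸-assoc m (m+n≤o⇒m≤o∸n 2 (subst (_≤ n) (+-comm m 2) m+2≤n)) ⟨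
  (m + (n ∸ m)) ∸ 2 ≡⟨ cong (_∸ 2) (m+[n∸m]≡n (m+n≤o⇒m≤o m m+2≤n)) ⟩
  n ∸ 2             ∎
  where open ≡-Reasoning

m∸n≤[m+p]∸[n+o] : ∀ m n {o p} → o ≤ p → m ∸ n ≤ (m + p) ∸ (n + o)
m∸n≤[m+p]∸[n+o] m n {o} {p} o≤p = begin
  m ∸ n             ≡⟨ [m+n]∸[m+o]≡n∸o o m n ⟨
  (o + m) ∸ (o + n) ≡⟨ cong₂ _∸_ (+-comm o m) (+-comm o n) ⟩
  (m + o) ∸ (n + o) ≤⟨ ∸-monoˡ-≤ (n + o) (+-monoʳ-≤ m o≤p) ⟩
  (m + p) ∸ (n + o) ∎
  where open ≤-Reasoning

module AlphaNumber (a b : ℕ → ℕ) (slope : IsSlope a) (ostrowski : IsAlphaNumber a b) where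

  private
    b₁≤a₁∸1 = proj₁ ostrowski
    b≤a     = proj₁ (proj₂ ostrowski)
    b≡a⇒b≡0 = proj₂ (proj₂ ostrowski)

  rho<q-step : ∀ n → rho a b n < q a n → rho a b (suc n) < q a (suc n) →
    rho a b (suc (suc n)) < q a (suc (suc n))
  rho<q-step n ih₀ ih₁ with m≤n⇒m<n∨m≡n (b≤a (suc n))
  ... | inj₁ b<a = begin-strict
    rho a b (suc n) + b (suc (suc n)) * q a (suc n) <⟨ +-monoˡ-< _ ih₁ ⟩
    suc (b (suc (suc n))) * q a (suc n)             ≤⟨ *-monoˡ-≤ (q a (suc n)) b<a ⟩
    a (suc (suc n)) * q a (suc n)                   ≤⟨ m≤m+n _ (q a n) ⟩
    a (suc (suc n)) * q a (suc n) + q a n           ≡⟨ q-recurrence a n ⟨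
    q a (suc (suc n))                               ∎
    where open ≤-Reasoning
  ... | inj₂ b≡a = begin-strict
    rho a b (suc n) + b (suc (suc n)) * q a (suc n) ≡⟨ cong₂ _+_ rho[n+1]≡rho[n] (cong (_* q a (suc n)) b≡a) ⟩
    rho a b n + a (suc (suc n)) * q a (suc n)       <⟨ +-monoˡ-< _ ih₀ ⟩
    q a n + a (suc (suc n)) * q a (suc n)           ≡⟨ +-comm (q a n) _ ⟩
    a (suc (suc n)) * q a (suc n) + q a n           ≡⟨ q-recurrence a n ⟨
    q a (suc (suc n))                               ∎
    where
      open ≤-Reasoning
      rho[n+1]≡rho[n] : rho a b (suc n) ≡ rho a b n
      rho[n+1]≡rho[n] = trans (cong (λ z → rho a b n + z * q a n) (b≡a⇒b≡0 n b≡a)) (+-identityʳ _)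

  rho<q : ∀ n → rho a b n < q a n
  rho<q zero = s≤s z≤n
  rho<q (suc zero) = begin-strict
    0 + b 1 * 1   ≡⟨ *-identityʳ (b 1) ⟩
    b 1           <⟨ s≤s b₁≤a₁∸1 ⟩
    1 + (a 1 ∸ 1) ≡⟨ m+[n∸m]≡n (slope 0) ⟩
    a 1           ≡⟨ trans (+-identityʳ (a 1 * 1)) (*-identityʳ (a 1)) ⟨
    a 1 * 1 + 0   ∎
    where open ≤-Reasoning
  rho<q (suc (suc n)) = rho<q-step n (rho<q n) (rho<q (suc n))

  rho[n+1]+2≤q[n+1]+q[n] : ∀ n → rho a b (suc n) + 2 ≤ q a (suc n) + q a n
  rho[n+1]+2≤q[n+1]+q[n] n = begin
    rho a b (suc n) + 2     ≡⟨ +-suc (rho a b (suc n)) 1 ⟩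
    suc (rho a b (suc n)) + 1 ≤⟨ +-mono-≤ (rho<q (suc n)) (0<q a slope n) ⟩
    q a (suc n) + q a n     ∎
    where open ≤-Reasoning

  rho+lam≡q+q∸2 : ∀ n → rho a b (suc n) + lam a b n ≡ (q a (suc n) + q a n) ∸ 2
  rho+lam≡q+q∸2 n = m+[n∸m∸2]≡n∸2 (rho[n+1]+2≤q[n+1]+q[n] n)

  lam-mono : ∀ n → lam a b n ≤ lam a b (suc n)
  lam-mono n = ∸-monoˡ-≤ 2 (begin
    (q a (suc n) + q a n) ∸ rho a b (suc n)
      ≤⟨ m∸n≤[m+p]∸[n+o] (q a (suc n) + q a n) (rho a b (suc n)) (*-monoˡ-≤ (q a (suc n)) (b≤a (suc n))) ⟩
    (q a (suc n) + q a n + a (suc (suc n)) * q a (suc n)) ∸ rho a b (suc (suc n))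
      ≡⟨ cong (_∸ rho a b (suc (suc n))) q+q+aq≡q+q ⟩
    (q a (suc (suc n)) + q a (suc n)) ∸ rho a b (suc (suc n)) ∎)
    where
      open ≤-Reasoning
      regroup : ∀ q₁ q₀ m → q₁ + q₀ + m ≡ m + q₀ + q₁
      regroup = solve-∀
      q+q+aq≡q+q : q a (suc n) + q a n + a (suc (suc n)) * q a (suc n) ≡ q a (suc (suc n)) + q a (suc n)
      q+q+aq≡q+q = trans (regroup (q a (suc n)) (q a n) (a (suc (suc n)) * q a (suc n))) (cong (_+ q a (suc n)) (sym (q-recurrence a n)))

  q∸1≤lam : ∀ n → q a n ∸ 1 ≤ lam a b n
  q∸1≤lam n = ∸-monoˡ-≤ 2 (m+n≤o⇒m≤o∸n (suc (q a n)) (begin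
    suc (q a n) + rho a b (suc n)   ≡⟨ cong suc (+-comm (q a n) (rho a b (suc n))) ⟩
    suc (rho a b (suc n)) + q a n   ≤⟨ +-monoˡ-≤ (q a n) (rho<q (suc n)) ⟩
    q a (suc n) + q a n             ∎))
    where open ≤-Reasoning

  lam-unbounded : ∀ M → ∃ λ N → ∀ n → N ≤ n → M ≤ lam a b n
  lam-unbounded M = suc M , λ { (suc n) (s≤s M≤n) →
    ≤-trans M≤n (≤-trans (∸-monoˡ-≤ 1 (n≤q a slope (suc n))) (q∸1≤lam (suc n))) }

mainTheorem11 : (a b : ℕ → ℕ) → IsSlope a → IsAlphaNumber a b →
    (∀ n → 1 ≤ n →
      SamePrefix (T^ (rho a b n) (charWord a)) (T^ (rho a b (suc n)) (charWord a)) (lam a b n))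
    × (∀ n → 1 ≤ n → b (suc n) ≢ 0 →
      IsLCPLength (T^ (rho a b n) (charWord a)) (T^ (rho a b (suc n)) (charWord a)) (lam a b n))
    × (∀ n → 1 ≤ n → lam a b n ≤ lam a b (suc n))
    × (∀ M → ∃ λ N → ∀ n → N ≤ n → M ≤ lam a b n)
mainTheorem11 a b slope ostrowski = samePrefix , isLCPLength , (λ n _ → lam-mono n) , lam-unbounded
  where
    open AlphaNumber a b slope ostrowski

    period : ∀ m → PeriodBrokenAt (charWord a) (q a (suc m)) ((q a (suc (suc m)) + q a (suc m)) ∸ 2)
    period = charWord-periodBrokenAt a slope

    samePrefix : ∀ n → 1 ≤ n →
      SamePrefix (T^ (rho a b n) (charWord a)) (T^ (rho a b (suc n)) (charWord a)) (lam a b n)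
    samePrefix (suc m) _ = samePrefix-shift-period (proj₁ (period m))
      (rho a b (suc m)) (b (suc (suc m))) (lam a b (suc m)) (rho+lam≡q+q∸2 (suc m))

    isLCPLength : ∀ n → 1 ≤ n → b (suc n) ≢ 0 →
      IsLCPLength (T^ (rho a b n) (charWord a)) (T^ (rho a b (suc n)) (charWord a)) (lam a b n)
    isLCPLength (suc m) _ = isLCPLength-shift-period (proj₁ (period m)) (0<q a slope (suc m)) (proj₂ (period m))
      (rho a b (suc m)) (b (suc (suc m))) (lam a b (suc m)) (rho+lam≡q+q∸2 (suc m))
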